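{- Let $p$ be a prime number and $\varepsilon\in\{1,-1\}$. Then for all $m=1,\dots,p-1$, $$S(\varepsilon+pm,\ p^2)=\varepsilon\left(\frac{2}{p^2}-2\right).$$ Moreover, if $m_1,m_2\in\{1,\dots,p^2-1\}$ are not divisible by $p$ and $S(m_1,p^2)=S(m_2,p^2)$, then $m_1\equiv m_2\pmod{p^2}$, or $m_1m_2\equiv 1\pmod{p^2}$, or there is $\varepsilon\in\{1,-1\}$ with $m_1\equiv m_2\equiv\varepsilon\pmod p$.
   Context: For a positive integer $n$ and an integer $m$ with $\gcd(m,n)=1$, the Dedekind sum is $s(m,n)=\sum_{k=1}^{n}((k/n))((mk/n))$, where $((t))=t-\lfloor t\rfloor-1/2$ if $t\in\mathbb{R}\setminus\mathbb{Z}$ and $((t))=0$ if $t\in\mathbb{Z}$. The normalized Dedekind sum is $S(m,n)=12\,s(m,n)$. -}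

module Defs where

open import Data.Nat as ℕ using (ℕ; zero; suc; NonZero)
open import Data.Integer as ℤ using (ℤ; +_)
open import Data.Integer.DivMod using (_%ℕ_)
open import Data.Rational as ℚ using (ℚ; 0ℚ; ½)
open import Relation.Nullary using (yes; no)

-- sawtooth ((a/n)) for an integer a and positive n:
-- 0 if n divides a, otherwise (a mod n)/n - 1/2 = a/n - floor(a/n) - 1/2
saw : ℤ → (n : ℕ) → .{{NonZero n}} → ℚ
saw a n with a %ℕ n ℕ.≟ 0
... | yes _ = 0ℚ
... | no  _ = ((+ (a %ℕ n)) ℚ./ n) ℚ.- ½

dsum : ℤ → (n : ℕ) → .{{NonZero n}} → ℕ → ℚ
dsum m n zero    = 0ℚ
dsum m n (suc j) = dsum m n j ℚ.+ (saw (+ suc j) n ℚ.* saw (m ℤ.* + suc j) n)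

dedekind : ℤ → (n : ℕ) → .{{NonZero n}} → ℚ
dedekind m n = dsum m n n

S : ℤ → (n : ℕ) → .{{NonZero n}} → ℚ
S m n = (ℤ.+ 12 ℚ./ 1) ℚ.* dedekind m n

open import Data.Nat.Primality using (Prime; prime)
open import Data.Nat.Properties using (m*n≢0)

prime²≢0 : ∀ {p} → Prime p → NonZero (p ℕ.* p)
prime²≢0 {p} (prime _) = m*n≢0 p p {{ℕ.nonTrivial⇒nonZero p}} {{ℕ.nonTrivial⇒nonZero p}}

-- With v k = 2k − n and u k = 2 (a k mod n) − n one has 4n² s(a, n) = Σ_{k<n} v k u k − n², and for
-- a unit a the u k are a permutation of the v k.
--
-- Values: by polarisation 2 Σ v u = 2 Σ v² − 4 Σ (a k mod n − k)².  For n = p², a = 1 + p m and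
-- k = i p + j one has a k mod n − k = p ((i + m j) mod p − i), a rotation of ℤ/p whose squares sum
-- to p c (p − c), c = m j mod p; as j ↦ m j mod p is a bijection, everything reduces to
-- Σ c (p − c) = p (p² − 1)/6.  The case ε = −1 follows from S(n − a, n) = −S(a, n).
--
-- Collisions: a v k − u k = n (2 ⌊a k / n⌋ + 1 − a), so expanding Σ (a v − u)² gives
-- (a² + 1) V ≡ 2 a Z (mod n²), where V = Σ v² = n (n² + 2)/3 and Z = Σ v u.  Eliminating Z between
-- a₁ and a₂ leaves n ∣ (a₁ a₂ − 1)(a₁ − a₂)(n² + 2).  For odd p, p ∤ n² + 2, so
-- p² ∣ (a₁ a₂ − 1)(a₁ − a₂); if p divides both factors then a₁² ≡ 1 and a₁ ≡ a₂ ≡ ±1 (mod p).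
module Submission where

open import Defs
open import Data.Nat as ℕ using (ℕ; suc; _≤_; _<_; NonZero)
open import Data.Nat.Primality using (Prime)
open import Data.Integer as ℤ using (ℤ; +_; -_; _-_)
open import Data.Integer.Divisibility using (_∣_)
open import Data.Rational as ℚ using (ℚ)
open import Data.Product using (_×_; Σ; ∃)
open import Data.Sum using (_⊎_)
open import Relation.Binary.PropositionalEquality using (_≡_)
open import Relation.Nullary using (¬_)

open import Data.Nat using (zero; z≤n; s≤s; _%_; _/_; _∸_)
import Data.Nat.Properties as ℕ
import Data.Nat.Divisibility as ℕ
open import Data.Nat.DivMod
open import Data.Nat.Coprimality as Coprime using (Coprime; coprime-Bézout; prime⇒coprime)
import Data.Nat.GCD as GCD
open import Data.Nat.Primality using (prime⇒irreducible; prime⇒nonTrivial; prime⇒nonZero; euclidsLemma)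
import Data.Nat.Tactic.RingSolver as ℕSolver
open import Data.Integer using (0ℤ; _+_; _*_)
import Data.Integer.Properties as ℤ
open import Data.Integer.DivMod using (_%ℕ_)
import Data.Integer.Divisibility.Signed as Sg
import Data.Integer.Coprimality as ℤCoprime
open import Data.Integer.Tactic.RingSolver using (solve-∀)
open import Data.Rational using (mkℚ; 0ℚ)
import Data.Rational.Properties as ℚ
open import Data.Rational.Unnormalised as ℚᵘ using (mkℚᵘ; *≡*)
import Data.Rational.Unnormalised.Properties as ℚᵘ
open import Data.Fin as Fin using (Fin; toℕ; fromℕ<)
import Data.Fin.Properties as Fin
open import Data.Fin.Permutation using (Permutation; permutation)
open import Data.Product using (_,_; proj₁; proj₂)
open import Data.Sum using (inj₁; inj₂)
open import Data.Empty using (⊥-elim)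
open import Function using (_∘_)
open import Relation.Nullary using (Dec; yes; no)
open import Relation.Binary.PropositionalEquality
  using (_≢_; refl; sym; trans; cong; cong₂; subst; module ≡-Reasoning)
import Algebra.Properties.Semiring.Sum as Sum


-- Finite sums over ℕ-indexed ranges

module ℤSum = Sum ℤ.+-*-semiring

∑ : ℕ → (ℕ → ℤ) → ℤ
∑ n f = ℤSum.sum {n} (f ∘ toℕ)

∑-cong : ∀ n {f g : ℕ → ℤ} → (∀ k → k < n → f k ≡ g k) → ∑ n f ≡ ∑ n g
∑-cong n f≗g = ℤSum.sum-cong-≗ (λ i → f≗g (toℕ i) (Fin.toℕ<n i))

∑-const : ∀ n c → ∑ n (λ _ → c) ≡ + n * c
∑-const zero    c = sym (ℤ.*-zeroˡ c)
∑-const (suc n) c = trans (cong (λ x → c + x) (∑-const n c)) (sym (ℤ.suc-* (+ n) c))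

∑-linear : ∀ n α β f g → ∑ n (λ k → α * f k + β * g k) ≡ α * ∑ n f + β * ∑ n g
∑-linear n α β f g = begin
  ∑ n (λ k → α * f k + β * g k)                ≡⟨ ℤSum.∑-distrib-+ {n} _ _ ⟩
  ∑ n (λ k → α * f k) + ∑ n (λ k → β * g k)
    ≡⟨ cong₂ _+_ (ℤSum.*-distribˡ-sum {n} α _) (ℤSum.*-distribˡ-sum {n} β _) ⟨
  α * ∑ n f + β * ∑ n g                        ∎
  where open ≡-Reasoning

∑-init-last : ∀ n f → ∑ (suc n) f ≡ ∑ n f + f n
∑-init-last n f = begin
  ∑ (suc n) f                            ≡⟨ ℤSum.sum-init-last {n} (f ∘ toℕ) ⟩
  ℤSum.sum {n} (f ∘ toℕ ∘ Fin.inject₁) + f (toℕ (Fin.fromℕ n))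
    ≡⟨ cong₂ _+_ (ℤSum.sum-cong-≗ {n} (cong f ∘ Fin.toℕ-inject₁)) (cong f (Fin.toℕ-fromℕ n)) ⟩
  ∑ n f + f n                            ∎
  where open ≡-Reasoning

∑-split : ∀ a b f → ∑ (a ℕ.+ b) f ≡ ∑ a f + ∑ b (λ k → f (a ℕ.+ k))
∑-split zero    b f = sym (ℤ.+-identityˡ _)
∑-split (suc a) b f = trans (cong (λ x → f 0 + x) (∑-split a b (f ∘ suc))) (sym (ℤ.+-assoc (f 0) _ _))

∑-blocks : ∀ b p f → ∑ (b ℕ.* p) f ≡ ∑ b (λ i → ∑ p (λ j → f (i ℕ.* p ℕ.+ j)))
∑-blocks zero    p f = refl
∑-blocks (suc b) p f = begin
  ∑ (p ℕ.+ b ℕ.* p) f                                       ≡⟨ ∑-split p (b ℕ.* p) f ⟩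
  ∑ p f + ∑ (b ℕ.* p) (λ k → f (p ℕ.+ k))
    ≡⟨ cong (λ x → ∑ p f + x) (∑-blocks b p (λ k → f (p ℕ.+ k))) ⟩
  ∑ p f + ∑ b (λ i → ∑ p (λ j → f (p ℕ.+ (i ℕ.* p ℕ.+ j))))
    ≡⟨ cong (λ x → ∑ p f + x) (∑-cong b (λ i _ → ∑-cong p (λ j _ → cong f (sym (ℕ.+-assoc p (i ℕ.* p) j))))) ⟩
  ∑ (suc b) (λ i → ∑ p (λ j → f (i ℕ.* p ℕ.+ j)))          ∎
  where open ≡-Reasoning

∑-reindex : ∀ n (φ ψ : ℕ → ℕ) →
            (∀ k → k < n → φ k < n) → (∀ k → k < n → ψ k < n) →
            (∀ k → k < n → ψ (φ k) ≡ k) → (∀ k → k < n → φ (ψ k) ≡ k) →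
            ∀ h → ∑ n (h ∘ φ) ≡ ∑ n h
∑-reindex n φ ψ φ< ψ< ψφ φψ h = begin
  ∑ n (h ∘ φ)                        ≡⟨ ℤSum.sum-cong-≗ {n} (λ i → cong h (sym (Fin.toℕ-fromℕ< _))) ⟩
  ℤSum.sum (h ∘ toℕ ∘ restrict φ φ<) ≡⟨ ℤSum.∑-permute (h ∘ toℕ) π ⟨
  ∑ n h                              ∎
  where
  open ≡-Reasoning
  restrict : (θ : ℕ → ℕ) → (∀ k → k < n → θ k < n) → Fin n → Fin n
  restrict θ θ< i = fromℕ< (θ< (toℕ i) (Fin.toℕ<n i))
  restrict-inverse : ∀ θ θ< χ χ< → (∀ k → k < n → θ (χ k) ≡ k) →
                     ∀ i → restrict θ θ< (restrict χ χ< i) ≡ i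
  restrict-inverse θ θ< χ χ< θχ i = Fin.toℕ-injective (begin
    toℕ (restrict θ θ< (restrict χ χ< i)) ≡⟨ Fin.toℕ-fromℕ< _ ⟩
    θ (toℕ (restrict χ χ< i))             ≡⟨ cong θ (Fin.toℕ-fromℕ< _) ⟩
    θ (χ (toℕ i))                         ≡⟨ θχ (toℕ i) (Fin.toℕ<n i) ⟩
    toℕ i                                 ∎)
  π : Permutation n n
  π = permutation (restrict φ φ<) (restrict ψ ψ<)
        (restrict-inverse φ φ< ψ ψ< φψ) (restrict-inverse ψ ψ< φ φ< ψφ)

Quadratic : ℤ → ℤ → ℤ → ℕ → ℤ
Quadratic A B C k = A * (+ k * + k) + B * + k + C

-- Quadratic A B C (1 + k) is again a quadratic in k, so the induction generalises the coefficients.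
∑-quadratic : ∀ n A B C →
  + 6 * ∑ n (Quadratic A B C)
    ≡ A * (+ n * (+ n - + 1) * (+ 2 * + n - + 1)) + + 3 * B * (+ n * (+ n - + 1)) + + 6 * + n * C
∑-quadratic zero    A B C = sym (closed-zero A B C)
  where
  closed-zero : ∀ A B C → A * (+ 0 * (+ 0 - + 1) * (+ 2 * + 0 - + 1)) + + 3 * B * (+ 0 * (+ 0 - + 1)) + + 6 * + 0 * C ≡ + 0
  closed-zero = solve-∀
∑-quadratic (suc n) A B C = begin
  + 6 * (Quadratic A B C 0 + ∑ n (Quadratic A B C ∘ suc))
    ≡⟨ cong (λ x → + 6 * (Quadratic A B C 0 + x)) (∑-cong n (λ k _ → shift A B C (+ k))) ⟩
  + 6 * (Quadratic A B C 0 + ∑ n (Quadratic A (+ 2 * A + B) (A + B + C)))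
    ≡⟨ ℤ.*-distribˡ-+ (+ 6) (Quadratic A B C 0) _ ⟩
  + 6 * Quadratic A B C 0 + + 6 * ∑ n (Quadratic A (+ 2 * A + B) (A + B + C))
    ≡⟨ cong (λ x → + 6 * Quadratic A B C 0 + x) (∑-quadratic n A (+ 2 * A + B) (A + B + C)) ⟩
  _ ≡⟨ step A B C (+ n) ⟩
  A * (+ suc n * (+ suc n - + 1) * (+ 2 * + suc n - + 1)) + + 3 * B * (+ suc n * (+ suc n - + 1)) + + 6 * + suc n * C ∎
  where
  open ≡-Reasoning
  shift : ∀ A B C k → A * ((+ 1 + k) * (+ 1 + k)) + B * (+ 1 + k) + C ≡ A * (k * k) + (+ 2 * A + B) * k + (A + B + C)
  shift = solve-∀
  step : ∀ A B C N →
    + 6 * (A * (+ 0 * + 0) + B * + 0 + C)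
      + (A * (N * (N - + 1) * (+ 2 * N - + 1)) + + 3 * (+ 2 * A + B) * (N * (N - + 1)) + + 6 * N * (A + B + C))
    ≡ A * ((+ 1 + N) * ((+ 1 + N) - + 1) * (+ 2 * (+ 1 + N) - + 1)) + + 3 * B * ((+ 1 + N) * ((+ 1 + N) - + 1)) + + 6 * (+ 1 + N) * C
  step = solve-∀

∑-k[p-k] : ∀ p → + 6 * ∑ p (λ k → + k * (+ p - + k)) ≡ + p * (+ p * + p - + 1)
∑-k[p-k] p = begin
  + 6 * ∑ p (λ k → + k * (+ p - + k))     ≡⟨ cong (+ 6 *_) (∑-cong p (λ k _ → expand (+ k) (+ p))) ⟩
  + 6 * ∑ p (Quadratic (- + 1) (+ p) 0ℤ)  ≡⟨ ∑-quadratic p (- + 1) (+ p) 0ℤ ⟩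
  _                                       ≡⟨ simplify (+ p) ⟩
  + p * (+ p * + p - + 1)                 ∎
  where
  open ≡-Reasoning
  expand : ∀ k p → k * (p - k) ≡ - + 1 * (k * k) + p * k + 0ℤ
  expand = solve-∀
  simplify : ∀ p → - + 1 * (p * (p - + 1) * (+ 2 * p - + 1)) + + 3 * p * (p * (p - + 1)) + + 6 * p * 0ℤ
                   ≡ p * (p * p - + 1)
  simplify = solve-∀


-- Residues and coprimality

[m%d*n]%d≡[m*n]%d : ∀ m n d .{{_ : NonZero d}} → (m % d ℕ.* n) % d ≡ (m ℕ.* n) % d
[m%d*n]%d≡[m*n]%d m n d = begin
  (m % d ℕ.* n) % d            ≡⟨ %-distribˡ-* (m % d) n d ⟩
  (m % d % d ℕ.* (n % d)) % d  ≡⟨ cong (λ x → (x ℕ.* (n % d)) % d) (m%n%n≡m%n m d) ⟩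
  (m % d ℕ.* (n % d)) % d      ≡⟨ %-distribˡ-* m n d ⟨
  (m ℕ.* n) % d                ∎
  where open ≡-Reasoning

[m*n%d]%d≡[m*n]%d : ∀ m n d .{{_ : NonZero d}} → (m ℕ.* (n % d)) % d ≡ (m ℕ.* n) % d
[m*n%d]%d≡[m*n]%d m n d = begin
  (m ℕ.* (n % d)) % d ≡⟨ cong (_% d) (ℕ.*-comm m (n % d)) ⟩
  (n % d ℕ.* m) % d   ≡⟨ [m%d*n]%d≡[m*n]%d n m d ⟩
  (n ℕ.* m) % d       ≡⟨ cong (_% d) (ℕ.*-comm n m) ⟩
  (m ℕ.* n) % d       ∎
  where open ≡-Reasoning

[m+n%d]%d≡[m+n]%d : ∀ m n d .{{_ : NonZero d}} → (m ℕ.+ n % d) % d ≡ (m ℕ.+ n) % d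
[m+n%d]%d≡[m+n]%d m n d = begin
  (m ℕ.+ n % d) % d           ≡⟨ %-distribˡ-+ m (n % d) d ⟩
  (m % d ℕ.+ n % d % d) % d   ≡⟨ cong (λ x → (m % d ℕ.+ x) % d) (m%n%n≡m%n n d) ⟩
  (m % d ℕ.+ n % d) % d       ≡⟨ %-distribˡ-+ m n d ⟨
  (m ℕ.+ n) % d               ∎
  where open ≡-Reasoning

coprime⇒inverse : ∀ {a n} .{{_ : NonZero n}} → Coprime a n → ∃ λ x → (x ℕ.* a) % n ≡ 1 % n
coprime⇒inverse {a} {n} c with coprime-Bézout c
... | GCD.Bézout.+- x y 1+yn≡xa = x , (begin
  (x ℕ.* a) % n       ≡⟨ cong (_% n) 1+yn≡xa ⟨
  (1 ℕ.+ y ℕ.* n) % n ≡⟨ [m+kn]%n≡m%n 1 y n ⟩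
  1 % n               ∎)
  where open ≡-Reasoning
... | GCD.Bézout.-+ x y 1+xa≡yn with n
...   | n@(suc n′) = x ℕ.* n′ , (begin
  (x ℕ.* n′ ℕ.* a) % n                   ≡⟨ [m+kn]%n≡m%n (x ℕ.* n′ ℕ.* a) 1 n ⟨
  (x ℕ.* n′ ℕ.* a ℕ.+ 1 ℕ.* n) % n       ≡⟨ cong (_% n) (regroup x a n′) ⟩
  (1 ℕ.+ (1 ℕ.+ x ℕ.* a) ℕ.* n′) % n     ≡⟨ cong (λ z → (1 ℕ.+ z ℕ.* n′) % n) 1+xa≡yn ⟩
  (1 ℕ.+ y ℕ.* n ℕ.* n′) % n             ≡⟨ cong (λ z → (1 ℕ.+ z) % n) (commute y n′) ⟩
  (1 ℕ.+ y ℕ.* n′ ℕ.* n) % n             ≡⟨ [m+kn]%n≡m%n 1 (y ℕ.* n′) n ⟩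
  1 % n                                  ∎)
  where
  open ≡-Reasoning
  regroup : ∀ x a n′ → x ℕ.* n′ ℕ.* a ℕ.+ 1 ℕ.* suc n′ ≡ 1 ℕ.+ (1 ℕ.+ x ℕ.* a) ℕ.* n′
  regroup = ℕSolver.solve-∀
  commute : ∀ y n′ → y ℕ.* suc n′ ℕ.* n′ ≡ y ℕ.* n′ ℕ.* suc n′
  commute = ℕSolver.solve-∀

inverse-cancel : ∀ x a {k n} .{{_ : NonZero n}} → (x ℕ.* a) % n ≡ 1 % n → k < n →
                 (x ℕ.* ((a ℕ.* k) % n)) % n ≡ k
inverse-cancel x a {k} {n} xa≡1 k<n = begin
  (x ℕ.* ((a ℕ.* k) % n)) % n ≡⟨ [m*n%d]%d≡[m*n]%d x (a ℕ.* k) n ⟩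
  (x ℕ.* (a ℕ.* k)) % n       ≡⟨ cong (_% n) (ℕ.*-assoc x a k) ⟨
  (x ℕ.* a ℕ.* k) % n         ≡⟨ [m%d*n]%d≡[m*n]%d (x ℕ.* a) k n ⟨
  ((x ℕ.* a) % n ℕ.* k) % n   ≡⟨ cong (λ z → (z ℕ.* k) % n) xa≡1 ⟩
  (1 % n ℕ.* k) % n           ≡⟨ [m%d*n]%d≡[m*n]%d 1 k n ⟩
  (1 ℕ.* k) % n               ≡⟨ cong (_% n) (ℕ.*-identityˡ k) ⟩
  k % n                       ≡⟨ m<n⇒m%n≡m k<n ⟩
  k                           ∎
  where open ≡-Reasoning

∑-reindex-*% : ∀ {a n} .{{_ : NonZero n}} → Coprime a n →
               ∀ h → ∑ n (λ k → h ((a ℕ.* k) % n)) ≡ ∑ n h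
∑-reindex-*% {a} {n} c h with coprime⇒inverse c
... | x , xa≡1 = ∑-reindex n (λ k → (a ℕ.* k) % n) (λ k → (x ℕ.* k) % n)
  (λ k _ → m%n<n (a ℕ.* k) n) (λ k _ → m%n<n (x ℕ.* k) n)
  (λ _ → inverse-cancel x a xa≡1) (λ _ → inverse-cancel a x (trans (cong (_% n) (ℕ.*-comm a x)) xa≡1)) h

coprime⇒[a*k]%n≢0 : ∀ {a n k} .{{_ : NonZero n}} → Coprime a n → 0 < k → k < n → (a ℕ.* k) % n ≢ 0
coprime⇒[a*k]%n≢0 {a} {n} {k} c 0<k k<n ak%n≡0 = ℕ.<⇒≱ k<n (ℕ.∣⇒≤ {{ℕ.>-nonZero 0<k}} n∣k)
  where
  n∣k : n ℕ.∣ k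
  n∣k = Coprime.coprime-divisor (Coprime.sym c) (ℕ.m%n≡0⇒n∣m (a ℕ.* k) n ak%n≡0)

[a*k]%n+[b*k]%n≡n : ∀ a b k {n} .{{_ : NonZero n}} → a ℕ.+ b ≡ n → (b ℕ.* k) % n ≢ 0 →
                    (a ℕ.* k) % n ℕ.+ (b ℕ.* k) % n ≡ n
[a*k]%n+[b*k]%n≡n a b k {n} a+b≡n bk%n≢0 = multiple≡n (ℕ.m%n≡0⇒n∣m T n T%n≡0)
  where
  open ≡-Reasoning
  T : ℕ
  T = (a ℕ.* k) % n ℕ.+ (b ℕ.* k) % n
  T%n≡0 : T % n ≡ 0
  T%n≡0 = begin
    T % n                       ≡⟨ %-distribˡ-+ (a ℕ.* k) (b ℕ.* k) n ⟨
    (a ℕ.* k ℕ.+ b ℕ.* k) % n   ≡⟨ cong (_% n) (ℕ.*-distribʳ-+ k a b) ⟨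
    ((a ℕ.+ b) ℕ.* k) % n       ≡⟨ cong (λ z → (z ℕ.* k) % n) a+b≡n ⟩
    (n ℕ.* k) % n               ≡⟨ cong (_% n) (ℕ.*-comm n k) ⟩
    (k ℕ.* n) % n               ≡⟨ m*n%n≡0 k n ⟩
    0                           ∎
  T<2n : T < n ℕ.+ n
  T<2n = ℕ.+-mono-< (m%n<n (a ℕ.* k) n) (m%n<n (b ℕ.* k) n)
  multiple≡n : n ℕ.∣ T → T ≡ n
  multiple≡n (ℕ.divides zero          T≡0)   = ⊥-elim (bk%n≢0 (ℕ.m+n≡0⇒n≡0 _ T≡0))
  multiple≡n (ℕ.divides (suc zero)    T≡n)   = trans T≡n (ℕ.+-identityʳ n)
  multiple≡n (ℕ.divides (suc (suc q)) T≡2+q) = ⊥-elim (ℕ.<⇒≱ T<2n 2n≤T)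
    where
    2n≤T : n ℕ.+ n ≤ T
    2n≤T = ℕ.≤-trans (ℕ.m≤m+n (n ℕ.+ n) (q ℕ.* n)) (ℕ.≤-reflexive (trans (ℕ.+-assoc n n (q ℕ.* n)) (sym T≡2+q)))

coprime-1+p*m : ∀ p m → Coprime (1 ℕ.+ p ℕ.* m) p
coprime-1+p*m p m {d} (d∣1+pm , d∣p) =
  ℕ.∣1⇒≡1 (ℕ.∣m+n∣m⇒∣n (subst (d ℕ.∣_) (ℕ.+-comm 1 (p ℕ.* m)) d∣1+pm) (ℕ.∣m⇒∣m*n m d∣p))

coprime-square : ∀ {a p} → Coprime a p → Coprime a (p ℕ.* p)
coprime-square {a} {p} c (d∣a , d∣p*p) = c (d∣a , Coprime.coprime-divisor d⊥p d∣p*p)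
  where
  d⊥p : Coprime _ p
  d⊥p (e∣d , e∣p) = c (ℕ.∣-trans e∣d d∣a , e∣p)

coprime-complement : ∀ {a b n} → a ℕ.+ b ≡ n → Coprime b n → Coprime a n
coprime-complement a+b≡n c {d} (d∣a , d∣n) =
  c (ℕ.∣m+n∣m⇒∣n (subst (d ℕ.∣_) (sym a+b≡n) d∣n) d∣a , d∣n)

¬∣⇒coprime : ∀ {p a} → Prime p → ¬ p ℕ.∣ a → Coprime p a
¬∣⇒coprime pr p∤a (d∣p , d∣a) with prime⇒irreducible pr d∣p
... | inj₁ d≡1 = d≡1
... | inj₂ refl = ⊥-elim (p∤a d∣a)

¬∣⇒coprime-square : ∀ {p a} → Prime p → ¬ p ℕ.∣ a → Coprime (p ℕ.* p) a
¬∣⇒coprime-square pr p∤a = Coprime.sym (coprime-square (Coprime.sym (¬∣⇒coprime pr p∤a)))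

pos-∸ : ∀ {m n} → n ≤ m → + (m ∸ n) ≡ + m - + n
pos-∸ {m} {n} n≤m = trans (sym (ℤ.⊖-≥ n≤m)) (sym (ℤ.m-n≡m⊖n m n))

-- The first p − c indices move up by c; the last c wrap around and move down by p − c.
∑-rotation² : ∀ {p c} .{{_ : NonZero p}} → c < p →
  ∑ p (λ i → (+ ((i ℕ.+ c) % p) - + i) * (+ ((i ℕ.+ c) % p) - + i)) ≡ + p * + c * (+ p - + c)
∑-rotation² {p} {c} c<p = begin
  ∑ p f                                                      ≡⟨ cong (λ x → ∑ x f) b+c≡p ⟨
  ∑ (b ℕ.+ c) f                                              ≡⟨ ∑-split b c f ⟩
  ∑ b f + ∑ c (λ j → f (b ℕ.+ j))
    ≡⟨ cong₂ _+_ (∑-cong b (λ _ → f-low)) (∑-cong c (λ _ → f-high)) ⟩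
  ∑ b (λ _ → + c * + c) + ∑ c (λ _ → (+ c - + p) * (+ c - + p)) ≡⟨ cong₂ _+_ (∑-const b _) (∑-const c _) ⟩
  + b * (+ c * + c) + + c * ((+ c - + p) * (+ c - + p))
    ≡⟨ cong (λ x → x * (+ c * + c) + + c * ((+ c - + p) * (+ c - + p))) b≡p-c ⟩
  (+ p - + c) * (+ c * + c) + + c * ((+ c - + p) * (+ c - + p)) ≡⟨ simplify (+ p) (+ c) ⟩
  + p * + c * (+ p - + c)                                    ∎
  where
  open ≡-Reasoning
  f : ℕ → ℤ
  f i = (+ ((i ℕ.+ c) % p) - + i) * (+ ((i ℕ.+ c) % p) - + i)
  b : ℕ
  b = p ∸ c
  b+c≡p : b ℕ.+ c ≡ p
  b+c≡p = ℕ.m∸n+n≡m (ℕ.<⇒≤ c<p)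
  b≡p-c : + b ≡ + p - + c
  b≡p-c = pos-∸ (ℕ.<⇒≤ c<p)
  shift-low : ∀ i c → (i + c - i) * (i + c - i) ≡ c * c
  shift-low = solve-∀
  shift-high : ∀ j p c → (j - ((p - c) + j)) * (j - ((p - c) + j)) ≡ (c - p) * (c - p)
  shift-high = solve-∀
  simplify : ∀ p c → (p - c) * (c * c) + c * ((c - p) * (c - p)) ≡ p * c * (p - c)
  simplify = solve-∀
  f-low : ∀ {i} → i < b → f i ≡ + c * + c
  f-low {i} i<b = begin
    f i
      ≡⟨ cong (λ x → (+ x - + i) * (+ x - + i)) (m<n⇒m%n≡m (subst (i ℕ.+ c <_) b+c≡p (ℕ.+-monoˡ-< c i<b))) ⟩
    (+ (i ℕ.+ c) - + i) * (+ (i ℕ.+ c) - + i) ≡⟨ cong (λ x → (x - + i) * (x - + i)) (ℤ.pos-+ i c) ⟩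
    (+ i + + c - + i) * (+ i + + c - + i)     ≡⟨ shift-low (+ i) (+ c) ⟩
    + c * + c                  ∎
  regroup : ∀ b j c → b ℕ.+ j ℕ.+ c ≡ j ℕ.+ (b ℕ.+ c)
  regroup = ℕSolver.solve-∀
  wrap : ∀ {j} → j < c → (b ℕ.+ j ℕ.+ c) % p ≡ j
  wrap {j} j<c = begin
    (b ℕ.+ j ℕ.+ c) % p   ≡⟨ cong (_% p) (trans (regroup b j c) (cong (j ℕ.+_) b+c≡p)) ⟩
    (j ℕ.+ p) % p         ≡⟨ [m+n]%n≡m%n j p ⟩
    j % p                 ≡⟨ m<n⇒m%n≡m (ℕ.<-trans j<c c<p) ⟩
    j                     ∎
  f-high : ∀ {j} → j < c → f (b ℕ.+ j) ≡ (+ c - + p) * (+ c - + p)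
  f-high {j} j<c = begin
    f (b ℕ.+ j)                                       ≡⟨ cong (λ x → (+ x - + (b ℕ.+ j)) * (+ x - + (b ℕ.+ j))) (wrap j<c) ⟩
    (+ j - + (b ℕ.+ j)) * (+ j - + (b ℕ.+ j))
      ≡⟨ cong (λ x → (+ j - x) * (+ j - x)) (trans (ℤ.pos-+ b j) (cong (_+ + j) b≡p-c)) ⟩
    (+ j - (+ p - + c + + j)) * (+ j - (+ p - + c + + j)) ≡⟨ shift-high (+ j) (+ p) (+ c) ⟩
    (+ c - + p) * (+ c - + p)                         ∎


-- The integer Dedekind sum

centred : ℕ → ℕ → ℤ
centred n r = + 2 * + r - + n

centredSquares : ℕ → ℤ
centredSquares n = ∑ n (λ k → centred n k * centred n k)

-- Σ_{k<n} v k u k, which is 4n² s(a, n) + n² when a is coprime to n.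
dedekindℤ : ℕ → (n : ℕ) → .{{NonZero n}} → ℤ
dedekindℤ a n = ∑ n (λ k → centred n k * centred n ((a ℕ.* k) % n))

displacement : ℕ → (n : ℕ) → .{{NonZero n}} → ℤ
displacement a n = ∑ n (λ k → (+ ((a ℕ.* k) % n) - + k) * (+ ((a ℕ.* k) % n) - + k))

centredSquares-value : ∀ n → + 3 * centredSquares n ≡ + n * (+ n * + n + + 2)
centredSquares-value n = ℤ.*-cancelˡ-≡ (+ 2) _ _ (begin
  + 2 * (+ 3 * centredSquares n)
    ≡⟨ ℤ.*-assoc (+ 2) (+ 3) _ ⟨
  + 6 * centredSquares n
    ≡⟨ cong (+ 6 *_) (∑-cong n (λ k _ → expand (+ k) (+ n))) ⟩
  + 6 * ∑ n (Quadratic (+ 4) (- (+ 4 * + n)) (+ n * + n))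
    ≡⟨ ∑-quadratic n (+ 4) (- (+ 4 * + n)) (+ n * + n) ⟩
  _ ≡⟨ simplify (+ n) ⟩
  + 2 * (+ n * (+ n * + n + + 2)) ∎)
  where
  open ≡-Reasoning
  expand : ∀ k n → (+ 2 * k - n) * (+ 2 * k - n) ≡ + 4 * (k * k) + - (+ 4 * n) * k + n * n
  expand = solve-∀
  simplify : ∀ n → + 4 * (n * (n - + 1) * (+ 2 * n - + 1)) + + 3 * - (+ 4 * n) * (n * (n - + 1)) + + 6 * n * (n * n)
                   ≡ + 2 * (n * (n * n + + 2))
  simplify = solve-∀

∑-centred²∘*% : ∀ {a n} .{{_ : NonZero n}} → Coprime a n →
                ∑ n (λ k → centred n ((a ℕ.* k) % n) * centred n ((a ℕ.* k) % n)) ≡ centredSquares n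
∑-centred²∘*% {n = n} c = ∑-reindex-*% c (λ r → centred n r * centred n r)

dedekindℤ-head : ∀ a n′ → let n = suc n′ in
  dedekindℤ a n ≡ + n * + n + ∑ n′ (λ k → centred n (suc k) * centred n ((a ℕ.* suc k) % n))
dedekindℤ-head a n′ = cong (_+ ∑ n′ (λ k → centred n (suc k) * centred n ((a ℕ.* suc k) % n))) (begin
  centred n 0 * centred n ((a ℕ.* 0) % n)  ≡⟨ cong (λ y → centred n 0 * centred n (y % n)) (ℕ.*-zeroʳ a) ⟩
  centred n 0 * centred n 0                ≡⟨ centred-zero (+ n) ⟩
  + n * + n                                ∎)
  where
  open ≡-Reasoning
  n : ℕ
  n = suc n′
  centred-zero : ∀ n → (+ 2 * + 0 - n) * (+ 2 * + 0 - n) ≡ n * n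
  centred-zero = solve-∀

dedekindℤ+2*displacement : ∀ {a n} .{{_ : NonZero n}} → Coprime a n →
                           dedekindℤ a n + + 2 * displacement a n ≡ centredSquares n
dedekindℤ+2*displacement {a} {n} c = ℤ.*-cancelˡ-≡ (+ 2) _ _ (begin
  + 2 * (dedekindℤ a n + + 2 * displacement a n)     ≡⟨ regroup (dedekindℤ a n) (displacement a n) ⟩
  + 2 * dedekindℤ a n + + 4 * displacement a n       ≡⟨ ∑-linear n (+ 2) (+ 4) (λ k → v k * u k) (λ k → d k * d k) ⟨
  ∑ n (λ k → + 2 * (v k * u k) + + 4 * (d k * d k))  ≡⟨ ∑-cong n (λ k _ → polarise (+ k) (+ r k) (+ n)) ⟩
  ∑ n (λ k → + 1 * (v k * v k) + + 1 * (u k * u k))  ≡⟨ ∑-linear n (+ 1) (+ 1) (λ k → v k * v k) (λ k → u k * u k) ⟩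
  + 1 * centredSquares n + + 1 * ∑ n (λ k → u k * u k)
    ≡⟨ cong (λ x → + 1 * centredSquares n + + 1 * x) (∑-centred²∘*% c) ⟩
  + 1 * centredSquares n + + 1 * centredSquares n    ≡⟨ double (centredSquares n) ⟩
  + 2 * centredSquares n                             ∎)
  where
  open ≡-Reasoning
  r : ℕ → ℕ
  r k = (a ℕ.* k) % n
  v u d : ℕ → ℤ
  v k = centred n k
  u k = centred n (r k)
  d k = + r k - + k
  regroup : ∀ Z D → + 2 * (Z + + 2 * D) ≡ + 2 * Z + + 4 * D
  regroup = solve-∀
  polarise : ∀ k r n → + 2 * ((+ 2 * k - n) * (+ 2 * r - n)) + + 4 * ((r - k) * (r - k))
                       ≡ + 1 * ((+ 2 * k - n) * (+ 2 * k - n)) + + 1 * ((+ 2 * r - n) * (+ 2 * r - n))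
  polarise = solve-∀
  double : ∀ V → + 1 * V + + 1 * V ≡ + 2 * V
  double = solve-∀

dedekindℤ-congruence : ∀ {a n} .{{_ : NonZero n}} → Coprime a n →
  ∃ λ W → (+ a * + a + + 1) * centredSquares n - + 2 * + a * dedekindℤ a n ≡ + n * + n * W
dedekindℤ-congruence {a} {n} c = ∑ n (λ k → w k * w k) , (begin
  (+ a * + a + + 1) * V - + 2 * + a * Z                          ≡⟨ regroup (+ a) V Z ⟩
  + a * + a * V + - (+ 2 * + a) * Z + V
    ≡⟨ cong (λ x → + a * + a * V + - (+ 2 * + a) * Z + x) (∑-centred²∘*% c) ⟨
  + a * + a * V + - (+ 2 * + a) * Z + ∑ n (λ k → u k * u k)
    ≡⟨ cong (_+ ∑ n (λ k → u k * u k)) (∑-linear n (+ a * + a) (- (+ 2 * + a)) (λ k → v k * v k) (λ k → v k * u k)) ⟨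
  ∑ n (λ k → + a * + a * (v k * v k) + - (+ 2 * + a) * (v k * u k)) + ∑ n (λ k → u k * u k)
    ≡⟨ ℤSum.∑-distrib-+ {n} _ _ ⟨
  ∑ n (λ k → + a * + a * (v k * v k) + - (+ 2 * + a) * (v k * u k) + u k * u k)
    ≡⟨ ∑-cong n (λ k _ → trans (square (+ a) (v k) (u k)) (cong (λ x → x * x) (a*v-u≡n*w k))) ⟩
  ∑ n (λ k → + n * w k * (+ n * w k))                            ≡⟨ ∑-cong n (λ k _ → factor (+ n) (w k)) ⟩
  ∑ n (λ k → + n * + n * (w k * w k))                            ≡⟨ ℤSum.*-distribˡ-sum {n} (+ n * + n) _ ⟨
  + n * + n * ∑ n (λ k → w k * w k)                              ∎)
  where
  open ≡-Reasoning
  V Z : ℤ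
  V = centredSquares n
  Z = dedekindℤ a n
  r q : ℕ → ℕ
  r k = (a ℕ.* k) % n
  q k = (a ℕ.* k) / n
  v u w : ℕ → ℤ
  v k = centred n k
  u k = centred n (r k)
  w k = + 2 * + q k + + 1 - + a
  regroup : ∀ a V Z → (a * a + + 1) * V - + 2 * a * Z ≡ a * a * V + - (+ 2 * a) * Z + V
  regroup = solve-∀
  square : ∀ a v u → a * a * (v * v) + - (+ 2 * a) * (v * u) + u * u ≡ (a * v - u) * (a * v - u)
  square = solve-∀
  factor : ∀ n w → n * w * (n * w) ≡ n * n * (w * w)
  factor = solve-∀
  expand : ∀ a k r n → a * (+ 2 * k - n) - (+ 2 * r - n) ≡ + 2 * (a * k) - a * n - + 2 * r + n
  expand = solve-∀
  a*k≡r+q*n : ∀ k → + a * + k ≡ + r k + + q k * + n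
  a*k≡r+q*n k = begin
    + a * + k                 ≡⟨ ℤ.pos-* a k ⟨
    + (a ℕ.* k)               ≡⟨ cong +_ (m≡m%n+[m/n]*n (a ℕ.* k) n) ⟩
    + (r k ℕ.+ q k ℕ.* n)     ≡⟨ ℤ.pos-+ (r k) (q k ℕ.* n) ⟩
    + r k + + (q k ℕ.* n)     ≡⟨ cong (λ x → + r k + x) (ℤ.pos-* (q k) n) ⟩
    + r k + + q k * + n       ∎
  gather : ∀ a r q n → + 2 * (r + q * n) - a * n - + 2 * r + n ≡ n * (+ 2 * q + + 1 - a)
  gather = solve-∀
  a*v-u≡n*w : ∀ k → + a * v k - u k ≡ + n * w k
  a*v-u≡n*w k = begin
    + a * v k - u k                                       ≡⟨ expand (+ a) (+ k) (+ r k) (+ n) ⟩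
    + 2 * (+ a * + k) - + a * + n - + 2 * + r k + + n     ≡⟨ cong (λ x → + 2 * x - + a * + n - + 2 * + r k + + n) (a*k≡r+q*n k) ⟩
    + 2 * (+ r k + + q k * + n) - + a * + n - + 2 * + r k + + n ≡⟨ gather (+ a) (+ r k) (+ q k) (+ n) ⟩
    + n * w k                                             ∎

dedekindℤ-reflection : ∀ {a b n} .{{_ : NonZero n}} → a ℕ.+ b ≡ n → Coprime b n →
                       dedekindℤ a n + dedekindℤ b n ≡ + 2 * (+ n * + n)
dedekindℤ-reflection {a} {b} {n@(suc n′)} a+b≡n c = begin
  dedekindℤ a n + dedekindℤ b n                            ≡⟨ cong₂ _+_ (dedekindℤ-head a n′) (dedekindℤ-head b n′) ⟩
  + n * + n + ∑ n′ (t a) + (+ n * + n + ∑ n′ (t b))         ≡⟨ regroup (+ n * + n) (∑ n′ (t a)) (∑ n′ (t b)) ⟩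
  + 2 * (+ n * + n) + (∑ n′ (t a) + ∑ n′ (t b))            ≡⟨ cong (λ x → + 2 * (+ n * + n) + x) tails-cancel ⟩
  + 2 * (+ n * + n) + 0ℤ                                   ≡⟨ ℤ.+-identityʳ _ ⟩
  + 2 * (+ n * + n)                                        ∎
  where
  open ≡-Reasoning
  t : ℕ → ℕ → ℤ
  t x k = centred n (suc k) * centred n ((x ℕ.* suc k) % n)
  regroup : ∀ N x y → N + x + (N + y) ≡ + 2 * N + (x + y)
  regroup = solve-∀
  opposite : ∀ v x y n → v * (+ 2 * x - n) + v * (+ 2 * y - n) ≡ v * (+ 2 * (x + y) - + 2 * n)
  opposite = solve-∀
  annihilate : ∀ v n → v * (+ 2 * n - + 2 * n) ≡ 0ℤ
  annihilate = solve-∀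
  t+t≡0 : ∀ {k} → suc k < n → t a k + t b k ≡ 0ℤ
  t+t≡0 {k} k<n = begin
    t a k + t b k                                       ≡⟨ opposite v (+ ra) (+ rb) (+ n) ⟩
    v * (+ 2 * (+ ra + + rb) - + 2 * + n)               ≡⟨ cong (λ x → v * (+ 2 * x - + 2 * + n)) (ℤ.pos-+ ra rb) ⟨
    v * (+ 2 * + (ra ℕ.+ rb) - + 2 * + n)               ≡⟨ cong (λ x → v * (+ 2 * + x - + 2 * + n)) ra+rb≡n ⟩
    v * (+ 2 * + n - + 2 * + n)                         ≡⟨ annihilate v (+ n) ⟩
    0ℤ                                                  ∎
    where
    v : ℤ
    v = centred n (suc k)
    ra rb : ℕ
    ra = (a ℕ.* suc k) % n
    rb = (b ℕ.* suc k) % n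
    ra+rb≡n : ra ℕ.+ rb ≡ n
    ra+rb≡n = [a*k]%n+[b*k]%n≡n a b (suc k) a+b≡n (coprime⇒[a*k]%n≢0 c (s≤s z≤n) k<n)
  tails-cancel : ∑ n′ (t a) + ∑ n′ (t b) ≡ 0ℤ
  tails-cancel = begin
    ∑ n′ (t a) + ∑ n′ (t b)              ≡⟨ ℤSum.∑-distrib-+ {n′} (t a ∘ toℕ) (t b ∘ toℕ) ⟨
    ∑ n′ (λ k → t a k + t b k)           ≡⟨ ∑-cong n′ (λ k k<n′ → t+t≡0 (s≤s k<n′)) ⟩
    ∑ n′ (λ _ → 0ℤ)                      ≡⟨ ∑-const n′ 0ℤ ⟩
    + n′ * 0ℤ                            ≡⟨ ℤ.*-zeroʳ (+ n′) ⟩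
    0ℤ                                   ∎


-- Rationals as fractions with a prescribed denominator

-- q ≃ x / d states q = x/d by cross-multiplication; it asks nothing of d, so that products of
-- denominators need no NonZero instance.
infix 4 _≃_/_
record _≃_/_ (q : ℚ) (x : ℤ) (d : ℕ) : Set where
  constructor cross
  field cross-multiplied : ℚ.↥ q * + d ≡ x * ℚ.↧ q

≃ᵘ⇒≃ : ∀ {q x d} → ℚ.toℚᵘ q ℚᵘ.≃ mkℚᵘ x d → q ≃ x / suc d
≃ᵘ⇒≃ {mkℚ _ _ _} (*≡* eq) = cross eq

≃⇒≃ᵘ : ∀ {q x d} → q ≃ x / suc d → ℚ.toℚᵘ q ℚᵘ.≃ mkℚᵘ x d
≃⇒≃ᵘ {mkℚ _ _ _} (cross eq) = *≡* eq

/-≃ : ∀ x d .{{_ : NonZero d}} → x ℚ./ d ≃ x / d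
/-≃ x (suc d) = ≃ᵘ⇒≃ (ℚ.toℚᵘ-fromℚᵘ (mkℚᵘ x d))

+-≃ : ∀ {p q x y d e} .{{_ : NonZero d}} .{{_ : NonZero e}} →
      p ≃ x / d → q ≃ y / e → p ℚ.+ q ≃ (x * + e + y * + d) / (d ℕ.* e)
+-≃ {p} {q} {d = suc _} {e = suc _} p≃ q≃ =
  ≃ᵘ⇒≃ (ℚᵘ.≃-trans (ℚ.toℚᵘ-homo-+ p q) (ℚᵘ.+-cong (≃⇒≃ᵘ p≃) (≃⇒≃ᵘ q≃)))

*-≃ : ∀ {p q x y d e} .{{_ : NonZero d}} .{{_ : NonZero e}} →
      p ≃ x / d → q ≃ y / e → p ℚ.* q ≃ (x * y) / (d ℕ.* e)
*-≃ {p} {q} {d = suc _} {e = suc _} p≃ q≃ =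
  ≃ᵘ⇒≃ (ℚᵘ.≃-trans (ℚ.toℚᵘ-homo-* p q) (ℚᵘ.*-cong (≃⇒≃ᵘ p≃) (≃⇒≃ᵘ q≃)))

-‿≃ : ∀ {p x d} .{{_ : NonZero d}} → p ≃ x / d → ℚ.- p ≃ (- x) / d
-‿≃ {p} {d = suc _} p≃ = ≃ᵘ⇒≃ (ℚᵘ.≃-trans (ℚ.toℚᵘ-homo‿- p) (ℚᵘ.-‿cong (≃⇒≃ᵘ p≃)))

≃-rescale : ∀ {p x y d e} .{{_ : NonZero d}} .{{_ : NonZero e}} →
            p ≃ x / d → x * + e ≡ y * + d → p ≃ y / e
≃-rescale {d = suc _} {e = suc _} p≃ eq = ≃ᵘ⇒≃ (ℚᵘ.≃-trans (≃⇒≃ᵘ p≃) (*≡* eq))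

≃-injective : ∀ {p x y d} → p ≃ x / d → p ≃ y / d → x ≡ y
≃-injective {mkℚ _ _ _} {x} {y} (cross p≃x) (cross p≃y) = ℤ.*-cancelʳ-≡ x y _ (trans (sym p≃x) p≃y)

≃⇒≡ : ∀ {p q x d} .{{_ : NonZero d}} → p ≃ x / d → q ≃ x / d → p ≡ q
≃⇒≡ {d = suc _} p≃ q≃ = ℚ.toℚᵘ-injective (ℚᵘ.≃-trans (≃⇒≃ᵘ p≃) (ℚᵘ.≃-sym (≃⇒≃ᵘ q≃)))

+-≃-common : ∀ {p q x y d} .{{_ : NonZero d}} → p ≃ x / d → q ≃ y / d → p ℚ.+ q ≃ (x + y) / d
+-≃-common {x = x} {y} {d@(suc _)} p≃ q≃ =
  ≃-rescale (+-≃ p≃ q≃) (trans (common x y (+ d)) (cong ((x + y) *_) (ℤ.pos-* d d)))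
  where
  common : ∀ x y d → (x * d + y * d) * d ≡ (x + y) * (d * d)
  common = solve-∀

saw-≃ : ∀ x {n r} .{{_ : NonZero n}} → x %ℕ n ≡ r → r ≢ 0 → saw x n ≃ centred n r / (n ℕ.* 2)
saw-≃ x {n} {r} x%n≡r r≢0 with x %ℕ n ℕ.≟ 0
... | yes x%n≡0 = ⊥-elim (r≢0 (trans (sym x%n≡r) x%n≡0))
... | no _ rewrite x%n≡r =
  subst (λ y → (+ r ℚ./ n) ℚ.- ℚ.½ ≃ y / (n ℕ.* 2)) (shape (+ r) (+ n))
    (+-≃ (/-≃ (+ r) n) (-‿≃ (/-≃ (+ 1) 2)))
  where
  shape : ∀ r n → r * + 2 + - + 1 * n ≡ + 2 * r - n
  shape = solve-∀

saw-zero : ∀ x {n} .{{_ : NonZero n}} → x %ℕ n ≡ 0 → saw x n ≡ 0ℚ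
saw-zero x {n} x%n≡0 with x %ℕ n ℕ.≟ 0
... | yes _       = refl
... | no x%n≢0    = ⊥-elim (x%n≢0 x%n≡0)

dsum-≃ : ∀ {a n} .{{_ : NonZero n}} → Coprime a n → ∀ {j} → j < n →
  dsum (+ a) n j ≃ ∑ j (λ k → centred n (suc k) * centred n ((a ℕ.* suc k) % n)) / (n ℕ.* 2 ℕ.* (n ℕ.* 2))
dsum-≃ c {zero}  _   = cross refl
dsum-≃ {a} {n@(suc _)} c {suc j} j<n =
  subst (λ y → dsum (+ a) n (suc j) ≃ y / (n ℕ.* 2 ℕ.* (n ℕ.* 2))) (sym (∑-init-last j term))
    (+-≃-common (dsum-≃ c (ℕ.<-trans (ℕ.n<1+n j) j<n))
      (*-≃ (saw-≃ (+ suc j) (m<n⇒m%n≡m j<n) (λ ()))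
           (saw-≃ (+ a * + suc j) (cong (_%ℕ n) (sym (ℤ.pos-* a (suc j)))) (coprime⇒[a*k]%n≢0 c (s≤s z≤n) j<n))))
  where
  term : ℕ → ℤ
  term k = centred n (suc k) * centred n ((a ℕ.* suc k) % n)

S-≃ : ∀ {a n} .{{_ : NonZero n}} → Coprime a n →
      S (+ a) n ≃ (+ 3 * (dedekindℤ a n - + n * + n)) / (n ℕ.* n)
S-≃ {a} {n@(suc n′)} c = ≃-rescale (*-≃ (/-≃ (+ 12) 1) dedekind≃) rescaled
  where
  open ≡-Reasoning
  Y : ℤ
  Y = ∑ n′ (λ k → centred n (suc k) * centred n ((a ℕ.* suc k) % n))
  last-term-vanishes : dedekind (+ a) n ≡ dsum (+ a) n n′
  last-term-vanishes = begin
    dsum (+ a) n n′ ℚ.+ saw (+ n) n ℚ.* saw (+ a * + n) n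
      ≡⟨ cong (λ q → dsum (+ a) n n′ ℚ.+ q ℚ.* saw (+ a * + n) n) (saw-zero (+ n) (n%n≡0 n)) ⟩
    dsum (+ a) n n′ ℚ.+ 0ℚ ℚ.* saw (+ a * + n) n
      ≡⟨ cong (dsum (+ a) n n′ ℚ.+_) (ℚ.*-zeroˡ (saw (+ a * + n) n)) ⟩
    dsum (+ a) n n′ ℚ.+ 0ℚ
      ≡⟨ ℚ.+-identityʳ (dsum (+ a) n n′) ⟩
    dsum (+ a) n n′ ∎
  dedekind≃ : dedekind (+ a) n ≃ Y / (n ℕ.* 2 ℕ.* (n ℕ.* 2))
  dedekind≃ = subst (λ q → q ≃ Y / (n ℕ.* 2 ℕ.* (n ℕ.* 2))) (sym last-term-vanishes) (dsum-≃ c (ℕ.n<1+n n′))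
  scale : ∀ Y n → + 12 * Y * (n * n) ≡ + 3 * (n * n + Y - n * n) * (+ 1 * (n * + 2 * (n * + 2)))
  scale = solve-∀
  rescaled : + 12 * Y * + (n ℕ.* n) ≡ + 3 * (dedekindℤ a n - + n * + n) * + (1 ℕ.* (n ℕ.* 2 ℕ.* (n ℕ.* 2)))
  rescaled = begin
    + 12 * Y * + (n ℕ.* n)
      ≡⟨ cong (+ 12 * Y *_) (ℤ.pos-* n n) ⟩
    + 12 * Y * (+ n * + n)
      ≡⟨ scale Y (+ n) ⟩
    + 3 * (+ n * + n + Y - + n * + n) * (+ 1 * (+ n * + 2 * (+ n * + 2)))
      ≡⟨ cong₂ (λ z w → + 3 * (z - + n * + n) * w) (dedekindℤ-head a n′) denominator ⟨
    + 3 * (dedekindℤ a n - + n * + n) * + (1 ℕ.* (n ℕ.* 2 ℕ.* (n ℕ.* 2))) ∎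
    where
    denominator : + (1 ℕ.* (n ℕ.* 2 ℕ.* (n ℕ.* 2))) ≡ + 1 * (+ n * + 2 * (+ n * + 2))
    denominator = trans (ℤ.pos-* 1 _)
      (cong (+ 1 *_) (trans (ℤ.pos-* (n ℕ.* 2) (n ℕ.* 2)) (cong₂ _*_ (ℤ.pos-* n 2) (ℤ.pos-* n 2))))

S-injective : ∀ {a₁ a₂ n} .{{_ : NonZero n}} → Coprime a₁ n → Coprime a₂ n →
              S (+ a₁) n ≡ S (+ a₂) n → dedekindℤ a₁ n ≡ dedekindℤ a₂ n
S-injective {a₁} {a₂} {n} c₁ c₂ S≡S = begin
  dedekindℤ a₁ n                        ≡⟨ restore (dedekindℤ a₁ n) (+ n * + n) ⟨
  dedekindℤ a₁ n - + n * + n + + n * + n ≡⟨ cong (_+ + n * + n) (ℤ.*-cancelˡ-≡ (+ 3) _ _ numerators≡) ⟩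
  dedekindℤ a₂ n - + n * + n + + n * + n ≡⟨ restore (dedekindℤ a₂ n) (+ n * + n) ⟩
  dedekindℤ a₂ n                        ∎
  where
  open ≡-Reasoning
  numerators≡ : + 3 * (dedekindℤ a₁ n - + n * + n) ≡ + 3 * (dedekindℤ a₂ n - + n * + n)
  numerators≡ = ≃-injective (subst (λ q → q ≃ _ / (n ℕ.* n)) S≡S (S-≃ c₁)) (S-≃ c₂)
  restore : ∀ z c → z - c + c ≡ z
  restore = solve-∀

S-value : ∀ {a n} .{{_ : NonZero n}} → Coprime a n → ∀ ε →
          + 3 * (dedekindℤ a n - + n * + n) ≡ ε * (+ 2 * + n - + 2 * (+ n * + n)) →
          S (+ a) n ≡ (ε ℚ./ 1) ℚ.* ((+ 2 ℚ./ n) ℚ.- (+ 2 ℚ./ 1))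
S-value {a} {n@(suc _)} c ε value = ≃⇒≡ (S-≃ c) (≃-rescale rhs≃ rescaled)
  where
  open ≡-Reasoning
  rhs≃ : (ε ℚ./ 1) ℚ.* ((+ 2 ℚ./ n) ℚ.- (+ 2 ℚ./ 1)) ≃ ε * (+ 2 * + 1 + - + 2 * + n) / (1 ℕ.* (n ℕ.* 1))
  rhs≃ = *-≃ (/-≃ ε 1) (+-≃ (/-≃ (+ 2) n) (-‿≃ (/-≃ (+ 2) 1)))
  scale : ∀ ε n → ε * (+ 2 * + 1 + - + 2 * n) * (n * n) ≡ ε * (+ 2 * n - + 2 * (n * n)) * (+ 1 * (n * + 1))
  scale = solve-∀
  rescaled : ε * (+ 2 * + 1 + - + 2 * + n) * + (n ℕ.* n) ≡ + 3 * (dedekindℤ a n - + n * + n) * + (1 ℕ.* (n ℕ.* 1))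
  rescaled = begin
    ε * (+ 2 * + 1 + - + 2 * + n) * + (n ℕ.* n)   ≡⟨ cong (ε * (+ 2 * + 1 + - + 2 * + n) *_) (ℤ.pos-* n n) ⟩
    ε * (+ 2 * + 1 + - + 2 * + n) * (+ n * + n)   ≡⟨ scale ε (+ n) ⟩
    ε * (+ 2 * + n - + 2 * (+ n * + n)) * (+ 1 * (+ n * + 1)) ≡⟨ cong₂ _*_ (sym value) denominator ⟩
    + 3 * (dedekindℤ a n - + n * + n) * + (1 ℕ.* (n ℕ.* 1)) ∎
    where
    denominator : + 1 * (+ n * + 1) ≡ + (1 ℕ.* (n ℕ.* 1))
    denominator = sym (trans (ℤ.pos-* 1 _) (cong (+ 1 *_) (ℤ.pos-* n 1)))


-- Values at 1 + p m modulo p²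

module _ {p : ℕ} .{{_ : NonZero p}} where

  private instance
    p²≢0 : NonZero (p ℕ.* p)
    p²≢0 = ℕ.m*n≢0 p p

  [1+p*m]*[i*p+j]%p² : ∀ m i {j} → j < p →
    ((1 ℕ.+ p ℕ.* m) ℕ.* (i ℕ.* p ℕ.+ j)) % (p ℕ.* p) ≡ (i ℕ.+ m ℕ.* j) % p ℕ.* p ℕ.+ j
  [1+p*m]*[i*p+j]%p² m i {j} j<p = begin
    ((1 ℕ.+ p ℕ.* m) ℕ.* (i ℕ.* p ℕ.+ j)) % (p ℕ.* p)
      ≡⟨ cong (_% (p ℕ.* p)) (expand p m i j) ⟩
    ((i ℕ.+ m ℕ.* j) ℕ.* p ℕ.+ j ℕ.+ m ℕ.* i ℕ.* (p ℕ.* p)) % (p ℕ.* p)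
      ≡⟨ [m+kn]%n≡m%n ((i ℕ.+ m ℕ.* j) ℕ.* p ℕ.+ j) (m ℕ.* i) (p ℕ.* p) ⟩
    ((i ℕ.+ m ℕ.* j) ℕ.* p ℕ.+ j) % (p ℕ.* p)
      ≡⟨ [m*n+o]%[p*n]≡[m*n]%[p*n]+o (i ℕ.+ m ℕ.* j) p j<p ⟩
    (i ℕ.+ m ℕ.* j) ℕ.* p % (p ℕ.* p) ℕ.+ j
      ≡⟨ cong (ℕ._+ j) (m%n*o≡m*o%[n*o] (i ℕ.+ m ℕ.* j) p p) ⟨
    (i ℕ.+ m ℕ.* j) % p ℕ.* p ℕ.+ j ∎
    where
    open ≡-Reasoning
    expand : ∀ p m i j →
      (1 ℕ.+ p ℕ.* m) ℕ.* (i ℕ.* p ℕ.+ j) ≡ (i ℕ.+ m ℕ.* j) ℕ.* p ℕ.+ j ℕ.+ m ℕ.* i ℕ.* (p ℕ.* p)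
    expand = ℕSolver.solve-∀

  displacement-[1+p*m] : ∀ {m} → Coprime m p →
    displacement (1 ℕ.+ p ℕ.* m) (p ℕ.* p) ≡ + p * + p * + p * ∑ p (λ c → + c * (+ p - + c))
  displacement-[1+p*m] {m} m⊥p = begin
    ∑ (p ℕ.* p) G
      ≡⟨ ∑-blocks p p G ⟩
    ∑ p (λ i → ∑ p (λ j → G (i ℕ.* p ℕ.+ j)))
      ≡⟨ ∑-cong p (λ i _ → ∑-cong p (λ _ → G-block i)) ⟩
    ∑ p (λ i → ∑ p (λ j → + p * + p * δ j i))
      ≡⟨ ℤSum.∑-comm {p} {p} (λ i j → + p * + p * δ (toℕ j) (toℕ i)) ⟩
    ∑ p (λ j → ∑ p (λ i → + p * + p * δ j i))
      ≡⟨ ∑-cong p (λ j _ → ℤSum.*-distribˡ-sum {p} (+ p * + p) (δ j ∘ toℕ)) ⟨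
    ∑ p (λ j → + p * + p * ∑ p (δ j))
      ≡⟨ ∑-cong p (λ j _ → cong (+ p * + p *_) (∑-δ j)) ⟩
    ∑ p (λ j → + p * + p * (+ p * + c j * (+ p - + c j)))
      ≡⟨ ∑-cong p (λ j _ → regroup (+ p) (+ c j)) ⟩
    ∑ p (λ j → + p * + p * + p * (+ c j * (+ p - + c j)))
      ≡⟨ ℤSum.*-distribˡ-sum {p} (+ p * + p * + p) _ ⟨
    + p * + p * + p * ∑ p (λ j → + c j * (+ p - + c j))
      ≡⟨ cong (+ p * + p * + p *_) (∑-reindex-*% m⊥p (λ c → + c * (+ p - + c))) ⟩
    + p * + p * + p * ∑ p (λ c → + c * (+ p - + c))
      ∎
    where
    open ≡-Reasoning
    a : ℕ
    a = 1 ℕ.+ p ℕ.* m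
    G : ℕ → ℤ
    G k = (+ ((a ℕ.* k) % (p ℕ.* p)) - + k) * (+ ((a ℕ.* k) % (p ℕ.* p)) - + k)
    δ : ℕ → ℕ → ℤ
    δ j i = (+ ((i ℕ.+ m ℕ.* j) % p) - + i) * (+ ((i ℕ.+ m ℕ.* j) % p) - + i)
    c : ℕ → ℕ
    c j = (m ℕ.* j) % p
    block : ∀ x i j p → (x * p + j - (i * p + j)) * (x * p + j - (i * p + j)) ≡ p * p * ((x - i) * (x - i))
    block = solve-∀
    regroup : ∀ p c → p * p * (p * c * (p - c)) ≡ p * p * p * (c * (p - c))
    regroup = solve-∀
    pos-*+ : ∀ x y z → + (x ℕ.* y ℕ.+ z) ≡ + x * + y + + z
    pos-*+ x y z = trans (ℤ.pos-+ (x ℕ.* y) z) (cong (_+ + z) (ℤ.pos-* x y))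
    G-block : ∀ i {j} → j < p → G (i ℕ.* p ℕ.+ j) ≡ + p * + p * δ j i
    G-block i {j} j<p = begin
      G (i ℕ.* p ℕ.+ j)
        ≡⟨ cong (λ r → (+ r - + (i ℕ.* p ℕ.+ j)) * (+ r - + (i ℕ.* p ℕ.+ j))) ([1+p*m]*[i*p+j]%p² m i j<p) ⟩
      (+ (x ℕ.* p ℕ.+ j) - + (i ℕ.* p ℕ.+ j)) * (+ (x ℕ.* p ℕ.+ j) - + (i ℕ.* p ℕ.+ j))
        ≡⟨ cong₂ (λ u v → (u - v) * (u - v)) (pos-*+ x p j) (pos-*+ i p j) ⟩
      (+ x * + p + + j - (+ i * + p + + j)) * (+ x * + p + + j - (+ i * + p + + j))
        ≡⟨ block (+ x) (+ i) (+ j) (+ p) ⟩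
      + p * + p * δ j i ∎
      where
      x : ℕ
      x = (i ℕ.+ m ℕ.* j) % p
    ∑-δ : ∀ j → ∑ p (δ j) ≡ + p * + c j * (+ p - + c j)
    ∑-δ j = begin
      ∑ p (δ j)   ≡⟨ ∑-cong p (λ i _ → cong (λ r → (+ r - + i) * (+ r - + i)) ([m+n%d]%d≡[m+n]%d i (m ℕ.* j) p)) ⟨
      ∑ p (λ i → (+ ((i ℕ.+ c j) % p) - + i) * (+ ((i ℕ.+ c j) % p) - + i)) ≡⟨ ∑-rotation² (m%n<n (m ℕ.* j) p) ⟩
      + p * + c j * (+ p - + c j) ∎

  dedekindℤ-[1+p*m] : ∀ {m} → Coprime m p → let N = + (p ℕ.* p) in
    + 3 * (dedekindℤ (1 ℕ.+ p ℕ.* m) (p ℕ.* p) - N * N) ≡ + 1 * (+ 2 * N - + 2 * (N * N))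
  dedekindℤ-[1+p*m] {m} m⊥p = begin
    + 3 * (Z - N * N)                                                   ≡⟨ split Z D N ⟩
    + 3 * (Z + + 2 * D) - + 6 * D - + 3 * (N * N)
      ≡⟨ cong₂ (λ u v → + 3 * u - + 6 * v - + 3 * (N * N))
               (dedekindℤ+2*displacement a⊥p²) (displacement-[1+p*m] m⊥p) ⟩
    + 3 * centredSquares (p ℕ.* p) - + 6 * (+ p * + p * + p * T) - + 3 * (N * N)
      ≡⟨ cong₂ (λ u v → u - v - + 3 * (N * N))
               (centredSquares-value (p ℕ.* p)) (trans (shuffle (+ p) T) (cong (+ p * + p * + p *_) (∑-k[p-k] p))) ⟩
    N * (N * N + + 2) - + p * + p * + p * (+ p * (+ p * + p - + 1)) - + 3 * (N * N)
      ≡⟨ cong (λ N → N * (N * N + + 2) - + p * + p * + p * (+ p * (+ p * + p - + 1)) - + 3 * (N * N)) (ℤ.pos-* p p) ⟩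
    _ ≡⟨ simplify (+ p) ⟩
    + 1 * (+ 2 * (+ p * + p) - + 2 * (+ p * + p * (+ p * + p)))
      ≡⟨ cong (λ N → + 1 * (+ 2 * N - + 2 * (N * N))) (ℤ.pos-* p p) ⟨
    + 1 * (+ 2 * N - + 2 * (N * N))                                     ∎
    where
    open ≡-Reasoning
    a : ℕ
    a = 1 ℕ.+ p ℕ.* m
    N Z D T : ℤ
    N = + (p ℕ.* p)
    Z = dedekindℤ a (p ℕ.* p)
    D = displacement a (p ℕ.* p)
    T = ∑ p (λ c → + c * (+ p - + c))
    a⊥p² : Coprime a (p ℕ.* p)
    a⊥p² = coprime-square (coprime-1+p*m p m)
    split : ∀ Z D N → + 3 * (Z - N * N) ≡ + 3 * (Z + + 2 * D) - + 6 * D - + 3 * (N * N)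
    split = solve-∀
    shuffle : ∀ p T → + 6 * (p * p * p * T) ≡ p * p * p * (+ 6 * T)
    shuffle = solve-∀
    simplify : ∀ p → p * p * (p * p * (p * p) + + 2) - p * p * p * (p * (p * p - + 1)) - + 3 * (p * p * (p * p))
                     ≡ + 1 * (+ 2 * (p * p) - + 2 * (p * p * (p * p)))
    simplify = solve-∀

  1≤p*m : ∀ {m} → 0 < m → 1 ≤ p ℕ.* m
  1≤p*m 0<m = ℕ.*-mono-≤ {1} {p} (ℕ.>-nonZero⁻¹ p) 0<m

  p*m∸1+[1+p*[p∸m]]≡p*p : ∀ {m} → 0 < m → m < p → p ℕ.* m ∸ 1 ℕ.+ (1 ℕ.+ p ℕ.* (p ∸ m)) ≡ p ℕ.* p
  p*m∸1+[1+p*[p∸m]]≡p*p {m} 0<m m<p = begin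
    p ℕ.* m ∸ 1 ℕ.+ (1 ℕ.+ p ℕ.* (p ∸ m))   ≡⟨ ℕ.+-assoc (p ℕ.* m ∸ 1) 1 (p ℕ.* (p ∸ m)) ⟨
    p ℕ.* m ∸ 1 ℕ.+ 1 ℕ.+ p ℕ.* (p ∸ m)     ≡⟨ cong (ℕ._+ p ℕ.* (p ∸ m)) (ℕ.m∸n+n≡m (1≤p*m 0<m)) ⟩
    p ℕ.* m ℕ.+ p ℕ.* (p ∸ m)               ≡⟨ ℕ.*-distribˡ-+ p m (p ∸ m) ⟨
    p ℕ.* (m ℕ.+ (p ∸ m))                   ≡⟨ cong (p ℕ.*_) (ℕ.m+[n∸m]≡n (ℕ.<⇒≤ m<p)) ⟩
    p ℕ.* p                                 ∎
    where open ≡-Reasoning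

  dedekindℤ-[p*m-1] : ∀ {m} → Coprime m p → 0 < m → m < p → let N = + (p ℕ.* p) in
    + 3 * (dedekindℤ (p ℕ.* m ∸ 1) (p ℕ.* p) - N * N) ≡ - + 1 * (+ 2 * N - + 2 * (N * N))
  dedekindℤ-[p*m-1] {m} m⊥p 0<m m<p = begin
    + 3 * (dedekindℤ a (p ℕ.* p) - N * N)                                      ≡⟨ cong (λ z → + 3 * (z - N * N)) Za≡2N²-Zb ⟩
    + 3 * (+ 2 * (N * N) - dedekindℤ b (p ℕ.* p) - N * N)                      ≡⟨ negate (dedekindℤ b (p ℕ.* p)) (N * N) ⟩
    - + 1 * (+ 3 * (dedekindℤ b (p ℕ.* p) - N * N))                            ≡⟨ cong (- + 1 *_) (dedekindℤ-[1+p*m] m′⊥p) ⟩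
    - + 1 * (+ 1 * (+ 2 * N - + 2 * (N * N)))                                   ≡⟨ cong (- + 1 *_) (ℤ.*-identityˡ _) ⟩
    - + 1 * (+ 2 * N - + 2 * (N * N))                                          ∎
    where
    open ≡-Reasoning
    negate : ∀ Z M → + 3 * (+ 2 * M - Z - M) ≡ - + 1 * (+ 3 * (Z - M))
    negate = solve-∀
    add-sub : ∀ x y → x ≡ x + y - y
    add-sub = solve-∀
    N : ℤ
    N = + (p ℕ.* p)
    m′ a b : ℕ
    m′ = p ∸ m
    a = p ℕ.* m ∸ 1
    b = 1 ℕ.+ p ℕ.* m′
    m′⊥p : Coprime m′ p
    m′⊥p = coprime-complement (ℕ.m∸n+n≡m (ℕ.<⇒≤ m<p)) m⊥p
    Za≡2N²-Zb : dedekindℤ a (p ℕ.* p) ≡ + 2 * (N * N) - dedekindℤ b (p ℕ.* p)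
    Za≡2N²-Zb = begin
      dedekindℤ a (p ℕ.* p)                                   ≡⟨ add-sub (dedekindℤ a (p ℕ.* p)) (dedekindℤ b (p ℕ.* p)) ⟩
      dedekindℤ a (p ℕ.* p) + dedekindℤ b (p ℕ.* p) - dedekindℤ b (p ℕ.* p)
        ≡⟨ cong (_- dedekindℤ b (p ℕ.* p))
                (dedekindℤ-reflection (p*m∸1+[1+p*[p∸m]]≡p*p 0<m m<p) (coprime-square (coprime-1+p*m p m′))) ⟩
      + 2 * (N * N) - dedekindℤ b (p ℕ.* p)                   ∎

  S-[ε+p*m] : ∀ {m} → Coprime m p → 0 < m → m < p → ∀ ε → ε ≡ + 1 ⊎ ε ≡ - + 1 →
              S (ε + + p * + m) (p ℕ.* p) ≡ (ε ℚ./ 1) ℚ.* ((+ 2 ℚ./ (p ℕ.* p)) ℚ.- (+ 2 ℚ./ 1))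
  S-[ε+p*m] {m} m⊥p 0<m m<p ε (inj₁ refl) =
    subst (λ x → S x (p ℕ.* p) ≡ _) (trans (ℤ.pos-+ 1 (p ℕ.* m)) (cong (λ x → + 1 + x) (ℤ.pos-* p m)))
      (S-value (coprime-square (coprime-1+p*m p m)) (+ 1) (dedekindℤ-[1+p*m] m⊥p))
  S-[ε+p*m] {m} m⊥p 0<m m<p ε (inj₂ refl) =
    subst (λ x → S x (p ℕ.* p) ≡ _)
      (trans (pos-∸ (1≤p*m 0<m)) (trans (cong (_- + 1) (ℤ.pos-* p m)) (ℤ.+-comm (+ p * + m) (- + 1))))
      (S-value (coprime-complement (p*m∸1+[1+p*[p∸m]]≡p*p 0<m m<p) (coprime-square (coprime-1+p*m p (p ∸ m))))
               (- + 1) (dedekindℤ-[p*m-1] m⊥p 0<m m<p))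


-- Collisions

dedekindℤ≡⇒∣ : ∀ {a₁ a₂ n} .{{_ : NonZero n}} → Coprime a₁ n → Coprime a₂ n →
               dedekindℤ a₁ n ≡ dedekindℤ a₂ n →
               + n ∣ + (n ℕ.* n ℕ.+ 2) * ((+ a₁ * + a₂ - + 1) * (+ a₁ - + a₂))
dedekindℤ≡⇒∣ {a₁} {a₂} {n} c₁ c₂ Z₁≡Z₂ =
  Sg.∣⇒∣ᵤ (Sg.divides K (ℤ.*-cancelˡ-≡ (+ n) (C * (A * B)) (K * + n) (begin
  + n * (C * (A * B))                                      ≡⟨ cong (λ x → + n * (x * (A * B))) C≡ ⟩
  + n * ((+ n * + n + + 2) * (A * B))                      ≡⟨ regroup (+ a₁) (+ a₂) (+ n) ⟩
  (A * B) * (+ n * (+ n * + n + + 2))                      ≡⟨ cong ((A * B) *_) (centredSquares-value n) ⟨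
  (A * B) * (+ 3 * V)                                      ≡⟨ eliminate (+ a₁) (+ a₂) V Z ⟩
  + 3 * (+ a₂ * X₁ - + a₁ * ((+ a₂ * + a₂ + + 1) * V - + 2 * + a₂ * Z))
    ≡⟨ cong₂ (λ x y → + 3 * (+ a₂ * x - + a₁ * y))
             (trans (cong (λ z → (+ a₁ * + a₁ + + 1) * V - + 2 * + a₁ * z) (sym Z₁≡Z₂)) e₁) e₂ ⟩
  + 3 * (+ a₂ * (+ n * + n * W₁) - + a₁ * (+ n * + n * W₂)) ≡⟨ factor (+ a₁) (+ a₂) (+ n) W₁ W₂ ⟩
  + n * (K * + n)                                          ∎)))
  where
  open ≡-Reasoning
  V Z X₁ A B C : ℤ
  V = centredSquares n
  Z = dedekindℤ a₂ n
  X₁ = (+ a₁ * + a₁ + + 1) * V - + 2 * + a₁ * Z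
  A = + a₁ * + a₂ - + 1
  B = + a₁ - + a₂
  C = + (n ℕ.* n ℕ.+ 2)
  W₁ W₂ K : ℤ
  W₁ = proj₁ (dedekindℤ-congruence c₁)
  W₂ = proj₁ (dedekindℤ-congruence c₂)
  K = + 3 * (+ a₂ * W₁ - + a₁ * W₂)
  e₁ : (+ a₁ * + a₁ + + 1) * V - + 2 * + a₁ * dedekindℤ a₁ n ≡ + n * + n * W₁
  e₁ = proj₂ (dedekindℤ-congruence c₁)
  e₂ : (+ a₂ * + a₂ + + 1) * V - + 2 * + a₂ * Z ≡ + n * + n * W₂
  e₂ = proj₂ (dedekindℤ-congruence c₂)
  C≡ : C ≡ + n * + n + + 2
  C≡ = trans (ℤ.pos-+ (n ℕ.* n) 2) (cong (_+ + 2) (ℤ.pos-* n n))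
  regroup : ∀ a₁ a₂ n → n * ((n * n + + 2) * ((a₁ * a₂ - + 1) * (a₁ - a₂)))
                        ≡ ((a₁ * a₂ - + 1) * (a₁ - a₂)) * (n * (n * n + + 2))
  regroup = solve-∀
  eliminate : ∀ a₁ a₂ V Z → ((a₁ * a₂ - + 1) * (a₁ - a₂)) * (+ 3 * V)
              ≡ + 3 * (a₂ * ((a₁ * a₁ + + 1) * V - + 2 * a₁ * Z) - a₁ * ((a₂ * a₂ + + 1) * V - + 2 * a₂ * Z))
  eliminate = solve-∀
  factor : ∀ a₁ a₂ n W₁ W₂ → + 3 * (a₂ * (n * n * W₁) - a₁ * (n * n * W₂))
                            ≡ n * (+ 3 * (a₂ * W₁ - a₁ * W₂) * n)
  factor = solve-∀

odd-prime∤p⁴+2 : ∀ {p} → Prime p → p ≢ 2 → ¬ p ℕ.∣ p ℕ.* p ℕ.* (p ℕ.* p) ℕ.+ 2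
odd-prime∤p⁴+2 {p} pr p≢2 p∣p⁴+2 = p≢2 (ℕ.≤-antisym (ℕ.∣⇒≤ p∣2) (ℕ.nonTrivial⇒n>1 p {{prime⇒nonTrivial pr}}))
  where
  p∣2 : p ℕ.∣ 2
  p∣2 = ℕ.∣m+n∣m⇒∣n p∣p⁴+2 (ℕ.∣m⇒∣m*n (p ℕ.* p) (ℕ.∣m⇒∣m*n p ℕ.∣-refl))

prime∣*⇒∣⊎∣ : ∀ {p} → Prime p → ∀ x y → + p ∣ x * y → + p ∣ x ⊎ + p ∣ y
prime∣*⇒∣⊎∣ {p} pr x y p∣xy = euclidsLemma ℤ.∣ x ∣ ℤ.∣ y ∣ pr (subst (p ℕ.∣_) (ℤ.abs-* x y) p∣xy)

x*y≡1∧x≡y⇒≡±1 : ∀ {p} → Prime p → ∀ x y → + p ∣ x * y - + 1 → + p ∣ x - y →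
                Σ ℤ (λ ε → (ε ≡ + 1 ⊎ ε ≡ - + 1) × + p ∣ x - ε × + p ∣ y - ε)
x*y≡1∧x≡y⇒≡±1 {p} pr x y p∣xy-1 p∣x-y = choose (prime∣*⇒∣⊎∣ pr (x - + 1) (x - - + 1) p∣x²-1)
  where
  x²-1 : ∀ x y → x * y - + 1 + x * (x - y) ≡ (x - + 1) * (x - - + 1)
  x²-1 = solve-∀
  shift : ∀ x y ε → x - ε - (x - y) ≡ y - ε
  shift = solve-∀
  signed : ∀ z → + p ∣ z → + p Sg.∣ z
  signed z = Sg.∣ᵤ⇒∣ {+ p} {z}
  p∣x²-1 : + p ∣ (x - + 1) * (x - - + 1)
  p∣x²-1 = Sg.∣⇒∣ᵤ (subst (+ p Sg.∣_) (x²-1 x y)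
             (Sg.∣m∣n⇒∣m+n (signed (x * y - + 1) p∣xy-1) (Sg.∣n⇒∣m*n x (signed (x - y) p∣x-y))))
  p∣y-ε : ∀ ε → + p ∣ x - ε → + p ∣ y - ε
  p∣y-ε ε p∣x-ε =
    Sg.∣⇒∣ᵤ (subst (+ p Sg.∣_) (shift x y ε) (Sg.∣m∣n⇒∣m-n (signed (x - ε) p∣x-ε) (signed (x - y) p∣x-y)))
  choose : + p ∣ x - + 1 ⊎ + p ∣ x - - + 1 → Σ ℤ (λ ε → (ε ≡ + 1 ⊎ ε ≡ - + 1) × + p ∣ x - ε × + p ∣ y - ε)
  choose (inj₁ p∣x-1) = + 1   , inj₁ refl , p∣x-1 , p∣y-ε (+ 1) p∣x-1
  choose (inj₂ p∣x+1) = - + 1 , inj₂ refl , p∣x+1 , p∣y-ε (- + 1) p∣x+1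

odd⇒2∣m-1 : ∀ {m} → ¬ 2 ℕ.∣ m → + 2 ∣ + m - + 1
odd⇒2∣m-1 {m} 2∤m = subst (+ 2 ∣_) m-1≡ (ℕ.n∣m*n (m / 2))
  where
  open ≡-Reasoning
  m%2≡1 : m % 2 ≡ 1
  m%2≡1 with m % 2 | m%n<n m 2 | ℕ.m%n≡0⇒n∣m m 2
  ... | 0 | _ | 2∣m = ⊥-elim (2∤m (2∣m refl))
  ... | 1 | _ | _   = refl
  ... | suc (suc _) | s≤s (s≤s ()) | _
  cancel : ∀ x → + 1 + x - + 1 ≡ x
  cancel = solve-∀
  m-1≡ : + (m / 2 ℕ.* 2) ≡ + m - + 1
  m-1≡ = begin
    + (m / 2 ℕ.* 2)               ≡⟨ cancel (+ (m / 2 ℕ.* 2)) ⟨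
    + 1 + + (m / 2 ℕ.* 2) - + 1   ≡⟨ cong (_- + 1) (ℤ.pos-+ 1 (m / 2 ℕ.* 2)) ⟨
    + (1 ℕ.+ m / 2 ℕ.* 2) - + 1   ≡⟨ cong (λ r → + (r ℕ.+ m / 2 ℕ.* 2) - + 1) m%2≡1 ⟨
    + (m % 2 ℕ.+ m / 2 ℕ.* 2) - + 1 ≡⟨ cong (λ x → + x - + 1) (m≡m%n+[m/n]*n m 2) ⟨
    + m - + 1                     ∎

S-collision : ∀ {p} (pr : Prime p) {m₁ m₂} → ¬ p ℕ.∣ m₁ → ¬ p ℕ.∣ m₂ →
  S (+ m₁) (p ℕ.* p) {{prime²≢0 pr}} ≡ S (+ m₂) (p ℕ.* p) {{prime²≢0 pr}} →
  (+ (p ℕ.* p) ∣ + m₁ - + m₂) ⊎ (+ (p ℕ.* p) ∣ + m₁ * + m₂ - + 1) ⊎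
  Σ ℤ (λ ε → (ε ≡ + 1 ⊎ ε ≡ - + 1) × + p ∣ + m₁ - ε × + p ∣ + m₂ - ε)
-- The elimination needs p ∤ n² + 2, which fails only for p = 2, where every m with 2 ∤ m is ≡ 1.
S-collision {p} pr {m₁} {m₂} p∤m₁ p∤m₂ S≡S with p ℕ.≟ 2
... | yes refl = inj₂ (inj₂ (+ 1 , inj₁ refl , odd⇒2∣m-1 p∤m₁ , odd⇒2∣m-1 p∤m₂))
... | no p≢2 = classify (p ℕ.∣? ℤ.∣ A ∣) (p ℕ.∣? ℤ.∣ B ∣)
  where
  n : ℕ
  n = p ℕ.* p
  instance
    n≢0 : NonZero n
    n≢0 = prime²≢0 pr
  A B : ℤ
  A = + m₁ * + m₂ - + 1
  B = + m₁ - + m₂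
  n∣AB : + n ∣ A * B
  n∣AB = ℤCoprime.coprime-divisor (+ n) (+ (n ℕ.* n ℕ.+ 2)) (A * B)
           (¬∣⇒coprime-square pr (odd-prime∤p⁴+2 pr p≢2)) (dedekindℤ≡⇒∣ c₁ c₂ (S-injective c₁ c₂ S≡S))
    where
    c₁ : Coprime m₁ n
    c₁ = coprime-square (Coprime.sym (¬∣⇒coprime pr p∤m₁))
    c₂ : Coprime m₂ n
    c₂ = coprime-square (Coprime.sym (¬∣⇒coprime pr p∤m₂))
  classify : Dec (p ℕ.∣ ℤ.∣ A ∣) → Dec (p ℕ.∣ ℤ.∣ B ∣) →
             (+ n ∣ B) ⊎ (+ n ∣ A) ⊎ Σ ℤ (λ ε → (ε ≡ + 1 ⊎ ε ≡ - + 1) × + p ∣ + m₁ - ε × + p ∣ + m₂ - ε)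
  classify _ (no p∤B) =
    inj₂ (inj₁ (ℤCoprime.coprime-divisor (+ n) B A (¬∣⇒coprime-square pr p∤B) (subst (+ n ∣_) (ℤ.*-comm A B) n∣AB)))
  classify (no p∤A) _ =
    inj₁ (ℤCoprime.coprime-divisor (+ n) A B (¬∣⇒coprime-square pr p∤A) n∣AB)
  classify (yes p∣A) (yes p∣B) = inj₂ (inj₂ (x*y≡1∧x≡y⇒≡±1 pr (+ m₁) (+ m₂) p∣A p∣B))

corollary3 : (p : ℕ) → (pr : Prime p) →
    ((ε : ℤ) → (ε ≡ + 1 ⊎ ε ≡ - (+ 1)) → (m : ℕ) → 1 ≤ m → m < p →
         S (ε ℤ.+ (+ p) ℤ.* (+ m)) (p ℕ.* p) {{prime²≢0 pr}}
           ≡ (ε ℚ./ 1) ℚ.* (((+ 2) ℚ./ (p ℕ.* p)) {{prime²≢0 pr}} ℚ.- ((+ 2) ℚ./ 1)))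
    × ((m₁ m₂ : ℕ) → 1 ≤ m₁ → m₁ < p ℕ.* p → 1 ≤ m₂ → m₂ < p ℕ.* p →
         ¬ (+ p ∣ + m₁) → ¬ (+ p ∣ + m₂) →
         S (+ m₁) (p ℕ.* p) {{prime²≢0 pr}} ≡ S (+ m₂) (p ℕ.* p) {{prime²≢0 pr}} →
         (+ (p ℕ.* p) ∣ (+ m₁ - + m₂))
         ⊎ (+ (p ℕ.* p) ∣ (+ m₁ ℤ.* + m₂ - + 1))
         ⊎ Σ ℤ (λ ε → (ε ≡ + 1 ⊎ ε ≡ - (+ 1)) × (+ p ∣ (+ m₁ - ε)) × (+ p ∣ (+ m₂ - ε))))
corollary3 p pr =
  (λ ε ε≡±1 m 0<m m<p → S-[ε+p*m] (m⊥p 0<m m<p) 0<m m<p ε ε≡±1) ,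
  (λ m₁ m₂ _ _ _ _ p∤m₁ p∤m₂ → S-collision pr p∤m₁ p∤m₂)
  where
  instance
    p≢0 : NonZero p
    p≢0 = prime⇒nonZero pr
  m⊥p : ∀ {m} → 0 < m → m < p → Coprime m p
  m⊥p 0<m m<p = Coprime.sym (prime⇒coprime pr {{ℕ.>-nonZero 0<m}} m<p)
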